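{- Let $R$ be an $F$-relator. The class of all $R$-simulations (1) contains all homomorphisms of $F$-coalgebras and their converses iff for every non-empty function $f$, $Ff\le Rf$ and $(Ff)^\circ\le R(f^\circ)$; (2) is closed under composition iff for all relations $r\subseteq X\times Y$ and $s\subseteq Y\times Z$ such that $s\cdot r$ is non-empty, $Rs\cdot Rr\le R(s\cdot r)$; (3) is closed under converses iff for every non-empty relation $r\subseteq X\times Y$, $R(r^\circ)=(Rr)^\circ$.
   Context: $F\colon\mathbf{Set}\to\mathbf{Set}$ is a functor. Relations $r\subseteq X\times Y$ are composed applicatively ($s\cdot r=\{(x,z)\mid\exists y.\ x\,r\,y\,s\,z\}$), ordered by inclusion, $r^\circ$ denotes the converse, and functions are regarded as relations. An $F$-relator $R$ is a monotone assignment of a relation $Rr\subseteq FX\times FY$ to each relation $r\subseteq X\times Y$. Given $F$-coalgebras $\alpha\colon X\to FX$ and $\beta\colon Y\to FY$, a relation $r\subseteq X\times Y$ is an $R$-simulation from $\alpha$ to $\beta$ if $r\le\beta^\circ\cdot Rr\cdot\alpha$, i.e. $x\,r\,y$ implies $\alpha(x)\,(Rr)\,\beta(y)$. -}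

module Defs where

open import Level using (0ℓ)
open import Data.Product using (Σ; ∃; ∃₂; _×_; _,_)
open import Function using (_∘_; id)
open import Relation.Binary.PropositionalEquality using (_≡_)
open import Relation.Binary.Core using (REL; _⇒_)

Rl : Set → Set → Set₁
Rl X Y = REL X Y 0ℓ

_° : ∀ {X Y} → Rl X Y → Rl Y X
(r °) y x = r x y

_·_ : ∀ {X Y Z} → Rl Y Z → Rl X Y → Rl X Z
(s · r) x z = ∃ λ y → r x y × s y z

infixr 9 _·_

graph : ∀ {X Y} → (X → Y) → Rl X Y
graph f x y = f x ≡ y

NonEmpty : ∀ {X Y} → Rl X Y → Set
NonEmpty r = ∃₂ r

_≐_ : ∀ {X Y} → Rl X Y → Rl X Y → Set
r ≐ s = (r ⇒ s) × (s ⇒ r)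

record Functor : Set₁ where
  field
    F      : Set → Set
    fmap   : ∀ {X Y} → (X → Y) → F X → F Y
    fmap-id : ∀ {X} (a : F X) → fmap id a ≡ a
    fmap-∘  : ∀ {X Y Z} (g : Y → Z) (f : X → Y) (a : F X) →
              fmap (g ∘ f) a ≡ fmap g (fmap f a)

record Relator (Fu : Functor) : Set₁ where
  open Functor Fu
  field
    R    : ∀ {X Y} → Rl X Y → Rl (F X) (F Y)
    mono : ∀ {X Y} {r s : Rl X Y} → r ⇒ s → R r ⇒ R s

module _ {Fu : Functor} (Rel : Relator Fu) where
  open Functor Fu
  open Relator Rel

  IsHom : ∀ {X Y} → (X → F X) → (Y → F Y) → (X → Y) → Set
  IsHom α β f = ∀ x → fmap f (α x) ≡ β (f x)

  IsSim : ∀ {X Y} → (X → F X) → (Y → F Y) → Rl X Y → Set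
  IsSim α β r = ∀ {x y} → r x y → R r (α x) (β y)

  SimsContainHoms : Set₁
  SimsContainHoms = ∀ {X Y} (α : X → F X) (β : Y → F Y) (f : X → Y) →
    IsHom α β f → IsSim α β (graph f) × IsSim β α (graph f °)

  Cond1 : Set₁
  Cond1 = ∀ {X Y} (f : X → Y) → NonEmpty (graph f) →
    (graph (fmap f) ⇒ R (graph f)) × ((graph (fmap f)) ° ⇒ R (graph f °))

  SimsClosedComp : Set₁
  SimsClosedComp = ∀ {X Y Z} (α : X → F X) (β : Y → F Y) (γ : Z → F Z)
    (r : Rl X Y) (s : Rl Y Z) → IsSim α β r → IsSim β γ s → IsSim α γ (s · r)

  Cond2 : Set₁
  Cond2 = ∀ {X Y Z} (r : Rl X Y) (s : Rl Y Z) → NonEmpty (s · r) →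
    (R s · R r) ⇒ R (s · r)

  SimsClosedConv : Set₁
  SimsClosedConv = ∀ {X Y} (α : X → F X) (β : Y → F Y) (r : Rl X Y) →
    IsSim α β r → IsSim β α (r °)

  Cond3 : Set₁
  Cond3 = ∀ {X Y} (r : Rl X Y) → NonEmpty r → R (r °) ≐ ((R r) °)

-- Each condition is the corresponding closure property restricted to
-- coalgebras with constant structure map: r is an R-simulation from const a
-- to const b exactly when R r a b (provided r is non-empty), and every f is
-- a homomorphism from const a to const (F f a).  Conversely, a simulation
-- condition only ever asks for R r between particular points α x and β y,
-- and the witnessing pair (x, y) makes the relation involved non-empty.
module Submission where

open import Defs
open import Data.Product using (_×_; _,_; proj₁; proj₂)
open import Function using (const)
open import Function.Bundles using (_⇔_; mk⇔)
open import Relation.Binary.PropositionalEquality using (_≡_; refl; cong; trans)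
open import Relation.Binary.Core using (_⇒_)

nonEmpty-° : ∀ {X Y} {r : Rl X Y} → NonEmpty r → NonEmpty (r °)
nonEmpty-° (x , y , rxy) = y , x , rxy

module _ {Fu : Functor} (Rel : Relator Fu) where
  open Functor Fu
  open Relator Rel

  const-sim : ∀ {X Y} {r : Rl X Y} {a b} → R r a b → IsSim Rel (const a) (const b) r
  const-sim q _ = q

  const-sim⁻¹ : ∀ {X Y} {r : Rl X Y} {a b} →
                IsSim Rel (const a) (const b) r → NonEmpty r → R r a b
  const-sim⁻¹ sim (_ , _ , rxy) = sim rxy

  const-hom : ∀ {X Y} (f : X → Y) (a : F X) → IsHom Rel (const a) (const (fmap f a)) f
  const-hom f a _ = refl

  simsContainHoms⇒cond1 : SimsContainHoms Rel → Cond1 Rel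
  simsContainHoms⇒cond1 H f f-ne = graph⇒ , graph°⇒
    where
    sims : ∀ a → IsSim Rel (const a) (const (fmap f a)) (graph f)
               × IsSim Rel (const (fmap f a)) (const a) (graph f °)
    sims a = H (const a) (const (fmap f a)) f (const-hom f a)

    graph⇒ : graph (fmap f) ⇒ R (graph f)
    graph⇒ {a} refl = const-sim⁻¹ (proj₁ (sims a)) f-ne

    graph°⇒ : graph (fmap f) ° ⇒ R (graph f °)
    graph°⇒ {y = a} refl = const-sim⁻¹ (proj₂ (sims a)) (nonEmpty-° f-ne)

  cond1⇒simsContainHoms : Cond1 Rel → SimsContainHoms Rel
  cond1⇒simsContainHoms C α β f hom =
    (λ {x} e → proj₁ (C f (x , _ , e)) (hom-step x e))
    , (λ {y} {x} e → proj₂ (C f (x , y , e)) (hom-step x e))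
    where
    hom-step : ∀ x {y} → f x ≡ y → fmap f (α x) ≡ β y
    hom-step x e = trans (hom x) (cong β e)

  simsClosedComp⇒cond2 : SimsClosedComp Rel → Cond2 Rel
  simsClosedComp⇒cond2 H r s s·r-ne (b , Rr-ab , Rs-bc) =
    const-sim⁻¹ (H _ (const b) _ r s (const-sim Rr-ab) (const-sim Rs-bc)) s·r-ne

  cond2⇒simsClosedComp : Cond2 Rel → SimsClosedComp Rel
  cond2⇒simsClosedComp C α β γ r s r-sim s-sim {x} {z} (y , rxy , syz) =
    C r s (x , z , y , rxy , syz) (β y , r-sim rxy , s-sim syz)

  simsClosedConv⇒cond3 : SimsClosedConv Rel → Cond3 Rel
  simsClosedConv⇒cond3 H r (x , y , rxy) =
    (λ q → H _ _ (r °) (const-sim q) rxy)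
    , (λ q → H _ _ r (const-sim q) rxy)

  cond3⇒simsClosedConv : Cond3 Rel → SimsClosedConv Rel
  cond3⇒simsClosedConv C α β r sim {y} {x} rxy =
    proj₂ (C r (x , y , rxy)) (sim rxy)

theorem3 : (Fu : Functor) (Rel : Relator Fu) →
    (SimsContainHoms Rel ⇔ Cond1 Rel) × (SimsClosedComp Rel ⇔ Cond2 Rel) × (SimsClosedConv Rel ⇔ Cond3 Rel)
theorem3 Fu Rel =
    mk⇔ (simsContainHoms⇒cond1 Rel) (cond1⇒simsContainHoms Rel)
  , mk⇔ (simsClosedComp⇒cond2 Rel) (cond2⇒simsClosedComp Rel)
  , mk⇔ (simsClosedConv⇒cond3 Rel) (cond3⇒simsClosedConv Rel)
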